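{- Let $k\geq 0$ be an integer. The Diophantine equation $2^x-(2^k\cdot 5)^y=z^2$ has only the non-negative integer solutions $(x,y,z)=(0,0,0)$ and $(x,y,z)=(1,0,1)$. -}

module Defs where

{-# OPTIONS --safe #-}
-- For y = 0 the equation is 2^x = 1 + z², impossible modulo 4 once x ≥ 2.
-- For y ≥ 1 the power (2^k·5)^y vanishes modulo 5; squares are 0, ±1 and odd
-- powers of 2 are ±2 modulo 5, so x = 2h is even.  Then
-- (2^h − z)(2^h + z) = 2^(ky)·5^y, where the two factors sum to 2^(h+1).  They
-- cannot both be divisible by 5, so one is a power of 2 and the other is
-- 2^j·5^y; but a power of 2 is never 2^i + 2^j·5^y, since 5^y ≡ 1 (mod 4)
-- and 5^y ≠ 1.

module Submission where

open import Defs
open import Data.Nat using (ℕ; _^_; _*_)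
open import Data.Integer using (ℤ; +_; _-_)
open import Data.Product using (_×_)
open import Data.Sum using (_⊎_)
open import Relation.Binary.PropositionalEquality using (_≡_)

open import Data.Nat using (zero; suc; _+_; _%_; _≤_; _≤?_; s≤s; z≤n)
open import Data.Nat.Properties
open import Data.Nat.Divisibility
open import Data.Nat.DivMod
open import Data.Nat.Primality
open import Data.Nat.Coprimality using (Coprime; coprime-divisor)
open import Data.Nat.Tactic.RingSolver using (solve-∀)
open import Data.Product using (∃; ∃₂; _,_)
open import Data.Sum using (inj₁; inj₂)
open import Data.Empty using (⊥-elim)
open import Relation.Nullary using (¬_; yes; no)
open import Relation.Nullary.Decidable using (from-yes)
open import Relation.Binary.PropositionalEquality
open ≡-Reasoning
import Data.Integer as ℤ
import Data.Integer.Properties as ℤ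
import Data.Integer.Tactic.RingSolver as ℤ

+m-+n≡+o⇒m≡n+o : ∀ m n o → + m - + n ≡ + o → m ≡ n + o
+m-+n≡+o⇒m≡n+o m n o eq = ℤ.+-injective (begin
  + m                   ≡⟨ i≡i-j+j (+ m) (+ n) ⟩
  + m - + n ℤ.+ + n     ≡⟨ cong (ℤ._+ + n) eq ⟩
  + o ℤ.+ + n           ≡⟨ ℤ.+-comm (+ o) (+ n) ⟩
  + (n + o)             ∎)
  where
  i≡i-j+j : ∀ i j → i ≡ i - j ℤ.+ j
  i≡i-j+j = ℤ.solve-∀

even-or-odd : ∀ n → ∃ λ m → n ≡ 2 * m ⊎ n ≡ 1 + 2 * m
even-or-odd zero = 0 , inj₁ refl
even-or-odd (suc n) with even-or-odd n
... | m , inj₁ refl = m , inj₂ refl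
... | m , inj₂ refl = suc m , inj₁ (cong suc (sym (+-suc m (m + 0))))

^-distribʳ-* : ∀ m n o → (m * n) ^ o ≡ m ^ o * n ^ o
^-distribʳ-* m n zero = refl
^-distribʳ-* m n (suc o) = begin
  m * n * (m * n) ^ o     ≡⟨ cong (m * n *_) (^-distribʳ-* m n o) ⟩
  m * n * (m ^ o * n ^ o) ≡⟨ *-*-interchange m n (m ^ o) (n ^ o) ⟩
  m * m ^ o * (n * n ^ o) ∎
  where
  *-*-interchange : ∀ a b c d → a * b * (c * d) ≡ a * c * (b * d)
  *-*-interchange = solve-∀

1+2*n≡2^q⇒n≡0 : ∀ n q → 1 + 2 * n ≡ 2 ^ q → n ≡ 0
1+2*n≡2^q⇒n≡0 zero    zero    _  = refl
1+2*n≡2^q⇒n≡0 (suc n) zero    ()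
1+2*n≡2^q⇒n≡0 n       (suc q) eq = ⊥-elim (even≢odd (2 ^ q) n (sym eq))

module _ {p : ℕ} (prime-p : Prime p) where
  private instance
    p≢0 : _
    p≢0 = prime⇒nonZero prime-p

  ∤⇒coprime : ∀ {n} → ¬ p ∣ n → Coprime n p
  ∤⇒coprime p∤n (d∣n , d∣p) with prime⇒irreducible prime-p d∣p
  ... | inj₁ d≡1 = d≡1
  ... | inj₂ refl = ⊥-elim (p∤n d∣n)

  ∣p^n⇒≡p^i : ∀ {d} n → d ∣ p ^ n → ∃ λ i → d ≡ p ^ i
  ∣p^n⇒≡p^i zero d∣1 = 0 , ∣1⇒≡1 d∣1
  ∣p^n⇒≡p^i {d} (suc n) d∣p*p^n with p ∣? d
  ... | no p∤d = ∣p^n⇒≡p^i n (coprime-divisor (∤⇒coprime p∤d) d∣p*p^n)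
  ... | yes (divides d′ refl)
    with ∣p^n⇒≡p^i n (*-cancelˡ-∣ p (subst (_∣ p * p ^ n) (*-comm d′ p) d∣p*p^n))
  ...   | i , refl = suc i , *-comm (p ^ i) p

  ∤⇒coprime-^ : ∀ {n a} → ¬ p ∣ a → Coprime (p ^ n) a
  ∤⇒coprime-^ {n} p∤a (d∣p^n , d∣a) with ∣p^n⇒≡p^i n d∣p^n
  ... | zero  , refl = refl
  ... | suc i , refl = ⊥-elim (p∤a (∣-trans (m∣m*n (p ^ i)) d∣a))

factorisation-of-p^m*q^n : ∀ {p q a b} → Prime p → Prime q → ∀ m n →
  ¬ q ∣ a → a * b ≡ p ^ m * q ^ n → ∃₂ λ i j → a ≡ p ^ i × b ≡ p ^ j * q ^ n
factorisation-of-p^m*q^n {p} {q} {a} prime-p prime-q m n q∤a ab≡p^m*q^n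
  with coprime-divisor (∤⇒coprime-^ prime-q {n} q∤a) (divides (p ^ m) ab≡p^m*q^n)
... | divides c refl with ∣p^n⇒≡p^i prime-p m (divides c (trans (sym ac≡p^m) (*-comm a c)))
                        | ∣p^n⇒≡p^i prime-p m (divides a (sym ac≡p^m))
  where
  instance
    q^n≢0 : _
    q^n≢0 = m^n≢0 q n {{prime⇒nonZero prime-q}}
  ac≡p^m : a * c ≡ p ^ m
  ac≡p^m = *-cancelʳ-≡ (a * c) (p ^ m) (q ^ n) (trans (*-assoc a c (q ^ n)) ab≡p^m*q^n)
... | i , refl | j , refl = i , j , refl , refl

-- Cancelling common factors of 2 leaves an odd and an even side unless i = j = 0,
-- and then 2 + 4w is a power of 2 only for w = 0.
2^i+2^j*[1+4w]≡2^q⇒w≡0 : ∀ i j q w → 2 ^ i + 2 ^ j * (1 + 4 * w) ≡ 2 ^ q → w ≡ 0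
2^i+2^j*[1+4w]≡2^q⇒w≡0 i j zero w eq = ⊥-elim (<-irrefl refl (subst (2 ≤_) eq
  (+-mono-≤ (m^n>0 2 i) (*-mono-≤ (m^n>0 2 j) (s≤s z≤n)))))
2^i+2^j*[1+4w]≡2^q⇒w≡0 zero zero (suc q) w eq =
  1+2*n≡2^q⇒n≡0 w q (*-cancelˡ-≡ _ _ 2 (trans (rearrange w) eq))
  where
  rearrange : ∀ w → 2 * (1 + 2 * w) ≡ 1 + 1 * (1 + 4 * w)
  rearrange = solve-∀
2^i+2^j*[1+4w]≡2^q⇒w≡0 zero (suc j) (suc q) w eq =
  ⊥-elim (even≢odd (2 ^ q) (2 ^ j * (1 + 4 * w))
    (sym (trans (cong suc (sym (*-assoc 2 (2 ^ j) _))) eq)))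
2^i+2^j*[1+4w]≡2^q⇒w≡0 (suc i) zero (suc q) w eq =
  ⊥-elim (even≢odd (2 ^ q) (2 ^ i + 2 * w) (sym (trans (rearrange (2 ^ i) w) eq)))
  where
  rearrange : ∀ a w → 1 + 2 * (a + 2 * w) ≡ 2 * a + 1 * (1 + 4 * w)
  rearrange = solve-∀
2^i+2^j*[1+4w]≡2^q⇒w≡0 (suc i) (suc j) (suc q) w eq =
  2^i+2^j*[1+4w]≡2^q⇒w≡0 i j q w
    (*-cancelˡ-≡ _ _ 2 (trans (rearrange (2 ^ i) (2 ^ j) (1 + 4 * w)) eq))
  where
  rearrange : ∀ a b c → 2 * (a + b * c) ≡ 2 * a + 2 * b * c
  rearrange = solve-∀

5^n≡1+4w : ∀ n → ∃ λ w → 5 ^ n ≡ 1 + 4 * w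
5^n≡1+4w zero = 0 , refl
5^n≡1+4w (suc n) with 5^n≡1+4w n
... | w , 5^n≡1+4w = 1 + 5 * w , (begin
  5 * 5 ^ n          ≡⟨ cong (5 *_) 5^n≡1+4w ⟩
  5 * (1 + 4 * w)    ≡⟨ rearrange w ⟩
  1 + 4 * (1 + 5 * w) ∎)
  where
  rearrange : ∀ w → 5 * (1 + 4 * w) ≡ 1 + 4 * (1 + 5 * w)
  rearrange = solve-∀

2^i+2^j*5^[1+n]≢2^q : ∀ i j n q → 2 ^ i + 2 ^ j * 5 ^ suc n ≢ 2 ^ q
2^i+2^j*5^[1+n]≢2^q i j n q eq with 5^n≡1+4w (suc n)
... | w , 5^[1+n]≡1+4w
  with 2^i+2^j*[1+4w]≡2^q⇒w≡0 i j q w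
         (subst (λ c → 2 ^ i + 2 ^ j * c ≡ 2 ^ q) 5^[1+n]≡1+4w eq)
... | refl with m*n≡1⇒m≡1 5 (5 ^ n) 5^[1+n]≡1+4w
... | ()

prime[5] : Prime 5
prime[5] = from-yes (prime? 5)

5∤2^q : ∀ q → ¬ 5 ∣ 2 ^ q
5∤2^q q 5∣2^q with ∣p^n⇒≡p^i prime[2] q 5∣2^q
... | i , 5≡2^i with 1+2*n≡2^q⇒n≡0 2 i 5≡2^i
... | ()

5∤a∧a*b≡2^m*5^[1+n]⇒a+b≢2^q : ∀ {a b} m n q → ¬ 5 ∣ a →
  a * b ≡ 2 ^ m * 5 ^ suc n → a + b ≢ 2 ^ q
5∤a∧a*b≡2^m*5^[1+n]⇒a+b≢2^q m n q 5∤a ab≡2^m*5^[1+n]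
  with factorisation-of-p^m*q^n prime[2] prime[5] m (suc n) 5∤a ab≡2^m*5^[1+n]
... | i , j , refl , refl = 2^i+2^j*5^[1+n]≢2^q i j n q

a*b≡2^m*5^[1+n]⇒a+b≢2^q : ∀ {a b} m n q → a * b ≡ 2 ^ m * 5 ^ suc n → a + b ≢ 2 ^ q
a*b≡2^m*5^[1+n]⇒a+b≢2^q {a} {b} m n q ab≡2^m*5^[1+n] a+b≡2^q with 5 ∣? a | 5 ∣? b
... | no 5∤a | _ = 5∤a∧a*b≡2^m*5^[1+n]⇒a+b≢2^q m n q 5∤a ab≡2^m*5^[1+n] a+b≡2^q
... | yes _ | no 5∤b = 5∤a∧a*b≡2^m*5^[1+n]⇒a+b≢2^q m n q 5∤b
  (trans (*-comm b a) ab≡2^m*5^[1+n]) (trans (+-comm b a) a+b≡2^q)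
... | yes 5∣a | yes 5∣b = 5∤2^q q (subst (5 ∣_) a+b≡2^q (∣m∣n⇒∣m+n 5∣a 5∣b))

square%4 : ∀ z → (z * z) % 4 ≡ 0 ⊎ (z * z) % 4 ≡ 1
square%4 z rewrite %-distribˡ-* z z 4 {{_}} with z % 4 | m%n<n z 4
... | 0 | _ = inj₁ refl
... | 1 | _ = inj₂ refl
... | 2 | _ = inj₁ refl
... | 3 | _ = inj₂ refl
... | suc (suc (suc (suc _))) | s≤s (s≤s (s≤s (s≤s ())))

square%5 : ∀ z → (z * z) % 5 ≡ 0 ⊎ (z * z) % 5 ≡ 1 ⊎ (z * z) % 5 ≡ 4
square%5 z rewrite %-distribˡ-* z z 5 {{_}} with z % 5 | m%n<n z 5
... | 0 | _ = inj₁ refl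
... | 1 | _ = inj₂ (inj₁ refl)
... | 2 | _ = inj₂ (inj₂ refl)
... | 3 | _ = inj₂ (inj₂ refl)
... | 4 | _ = inj₂ (inj₁ refl)
... | suc (suc (suc (suc (suc _)))) | s≤s (s≤s (s≤s (s≤s (s≤s ()))))

2^[1+2[1+m]]≡4*2^[1+2m] : ∀ m → 2 ^ (1 + 2 * suc m) ≡ 4 * 2 ^ (1 + 2 * m)
2^[1+2[1+m]]≡4*2^[1+2m] m = begin
  2 ^ (1 + 2 * suc m)       ≡⟨ cong (λ e → 2 ^ (1 + e)) (*-suc 2 m) ⟩
  2 * (2 * 2 ^ (1 + 2 * m)) ≡⟨ *-assoc 2 2 (2 ^ (1 + 2 * m)) ⟨
  4 * 2 ^ (1 + 2 * m)       ∎

2^[1+2m]%5 : ∀ m → 2 ^ (1 + 2 * m) % 5 ≡ 2 ⊎ 2 ^ (1 + 2 * m) % 5 ≡ 3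
2^[1+2m]%5 zero = inj₁ refl
2^[1+2m]%5 (suc m)
  rewrite 2^[1+2[1+m]]≡4*2^[1+2m] m | %-distribˡ-* 4 (2 ^ (1 + 2 * m)) 5 {{_}}
  with 2^[1+2m]%5 m
... | inj₁ r≡2 rewrite r≡2 = inj₂ refl
... | inj₂ r≡3 rewrite r≡3 = inj₁ refl

2^[1+2m]%5≢[z*z]%5 : ∀ m z → 2 ^ (1 + 2 * m) % 5 ≢ (z * z) % 5
2^[1+2m]%5≢[z*z]%5 m z with 2^[1+2m]%5 m | square%5 z
... | inj₁ r≡2 | inj₁ s≡0        rewrite r≡2 | s≡0 = λ ()
... | inj₁ r≡2 | inj₂ (inj₁ s≡1) rewrite r≡2 | s≡1 = λ ()
... | inj₁ r≡2 | inj₂ (inj₂ s≡4) rewrite r≡2 | s≡4 = λ ()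
... | inj₂ r≡3 | inj₁ s≡0        rewrite r≡3 | s≡0 = λ ()
... | inj₂ r≡3 | inj₂ (inj₁ s≡1) rewrite r≡3 | s≡1 = λ ()
... | inj₂ r≡3 | inj₂ (inj₂ s≡4) rewrite r≡3 | s≡4 = λ ()

[1+z*z]%4≢0 : ∀ z → (1 + z * z) % 4 ≢ 0
[1+z*z]%4≢0 z rewrite %-distribˡ-+ 1 (z * z) 4 {{_}} with square%4 z
... | inj₁ s≡0 rewrite s≡0 = λ ()
... | inj₂ s≡1 rewrite s≡1 = λ ()

difference-of-squares : ∀ t n z → t * t ≡ n + z * z →
  ∃ λ a → a * (a + 2 * z) ≡ n × a + (a + 2 * z) ≡ 2 * t
difference-of-squares t n z eq with z ≤? t
... | no z≰t = ⊥-elim (<-irrefl eq (<-≤-trans (*-mono-< t<z t<z) (m≤n+m (z * z) n)))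
  where
  t<z = ≰⇒> z≰t
... | yes z≤t with m≤n⇒∃[o]m+o≡n z≤t
... | a , refl = a , +-cancelʳ-≡ (z * z) _ _ (trans (expand a z) eq) , regroup a z
  where
  expand : ∀ a z → a * (a + 2 * z) + z * z ≡ (z + a) * (z + a)
  expand = solve-∀
  regroup : ∀ a z → a + (a + 2 * z) ≡ 2 * (z + a)
  regroup = solve-∀

2^x≡1+z*z⇒[x,z]≡[0,0]∨[1,1] : ∀ x z → 2 ^ x ≡ 1 + z * z →
  (x ≡ 0 × z ≡ 0) ⊎ (x ≡ 1 × z ≡ 1)
2^x≡1+z*z⇒[x,z]≡[0,0]∨[1,1] zero zero _ = inj₁ (refl , refl)
2^x≡1+z*z⇒[x,z]≡[0,0]∨[1,1] zero (suc z) ()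
2^x≡1+z*z⇒[x,z]≡[0,0]∨[1,1] 1 z eq =
  inj₂ (refl , m*n≡1⇒m≡1 z z (sym (suc-injective eq)))
2^x≡1+z*z⇒[x,z]≡[0,0]∨[1,1] (suc (suc x)) z eq = ⊥-elim ([1+z*z]%4≢0 z (begin
  (1 + z * z) % 4 ≡⟨ cong (_% 4) eq ⟨
  2 ^ (2 + x) % 4 ≡⟨ n∣m⇒m%n≡0 _ 4 (divides (2 ^ x) (rearrange (2 ^ x))) ⟩
  0               ∎))
  where
  rearrange : ∀ a → 2 * (2 * a) ≡ a * 4
  rearrange = solve-∀

2^x≢2^m*5^[1+n]+z*z : ∀ x m n z → 2 ^ x ≢ 2 ^ m * 5 ^ suc n + z * z
2^x≢2^m*5^[1+n]+z*z x m n z eq with even-or-odd x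
... | h , inj₂ refl = 2^[1+2m]%5≢[z*z]%5 h z (begin
  2 ^ (1 + 2 * h) % 5             ≡⟨ cong (_% 5) eq ⟩
  (2 ^ m * 5 ^ suc n + z * z) % 5 ≡⟨ cong (_% 5) (rearrange (2 ^ m) (5 ^ n) (z * z)) ⟩
  (z * z + 2 ^ m * 5 ^ n * 5) % 5 ≡⟨ [m+kn]%n≡m%n (z * z) (2 ^ m * 5 ^ n) 5 ⟩
  (z * z) % 5                     ∎)
  where
  rearrange : ∀ a b c → a * (5 * b) + c ≡ c + a * b * 5
  rearrange = solve-∀
... | h , inj₁ refl
  with difference-of-squares (2 ^ h) (2 ^ m * 5 ^ suc n) z (trans (sym 2^[2h]≡2^h*2^h) eq)
  where
  2^[2h]≡2^h*2^h : 2 ^ (2 * h) ≡ 2 ^ h * 2 ^ h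
  2^[2h]≡2^h*2^h = trans (cong (λ e → 2 ^ (h + e)) (+-identityʳ h)) (^-distribˡ-+-* 2 h h)
... | a , ab≡2^m*5^[1+n] , a+b≡2^[1+h] =
  a*b≡2^m*5^[1+n]⇒a+b≢2^q {a} {a + 2 * z} m n (suc h) ab≡2^m*5^[1+n] a+b≡2^[1+h]

theorem3p4 : (k x y z : ℕ) →
    (+ (2 ^ x)) - (+ ((2 ^ k * 5) ^ y)) ≡ + (z * z) →
    (x ≡ 0 × y ≡ 0 × z ≡ 0) ⊎ (x ≡ 1 × y ≡ 0 × z ≡ 1)
theorem3p4 k x zero z eq
  with 2^x≡1+z*z⇒[x,z]≡[0,0]∨[1,1] x z (+m-+n≡+o⇒m≡n+o _ _ _ eq)
... | inj₁ (refl , refl) = inj₁ (refl , refl , refl)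
... | inj₂ (refl , refl) = inj₂ (refl , refl , refl)
theorem3p4 k x (suc y) z eq = ⊥-elim (2^x≢2^m*5^[1+n]+z*z x (k * suc y) y z (begin
  2 ^ x                               ≡⟨ +m-+n≡+o⇒m≡n+o _ _ _ eq ⟩
  (2 ^ k * 5) ^ suc y + z * z         ≡⟨ cong (_+ z * z) (^-distribʳ-* (2 ^ k) 5 (suc y)) ⟩
  (2 ^ k) ^ suc y * 5 ^ suc y + z * z
    ≡⟨ cong (λ e → e * 5 ^ suc y + z * z) (^-*-assoc 2 k (suc y)) ⟩
  2 ^ (k * suc y) * 5 ^ suc y + z * z ∎))
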